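{- Let $k$ be a positive integer and let $G=(V,E)$ be a simple graph that is $(k,2k)$-sparse. Let $u,v\in V$ be two distinct nodes such that $uv\notin E$. Let $D$ be an orientation of $G$ in which every node has indegree at most $k$ and the indegrees of $u$ and $v$ are both zero. Then the graph $G+uv$ is $(k,2k)$-sparse if and only if, for each node $w\in V\setminus\{u,v\}$, there exists a directed path in $D$ to $w$ from some node that is distinct from $u$ and $v$ and has indegree (in $D$) smaller than $k$.
   Context: For a graph $H$ and $X\subseteq V(H)$, let $i_H(X)$ denote the number of edges of $H$ with both endpoints in $X$. A simple graph $H$ is called $(k,2k)$-sparse if $i_H(X)\le k|X|-2k$ for every node set $X$ with $|X|\ge 3$ (no condition is imposed on sets of size at most two). $G+uv$ denotes the graph obtained from $G$ by adding the edge $uv$. An orientation of $G$ is a directed graph obtained by directing each edge of $G$; the indegree of a node is the number of arcs entering it. A directed path may consist of a single node (so a node $w$ itself of indegree smaller than $k$ counts as a path to $w$ from itself). -}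

module Defs where

open import Data.Nat using (ℕ; zero; suc; _+_; _*_; _∸_; _≤_; _<_)
open import Data.Bool using (Bool; true; false; _∧_; _∨_; if_then_else_)
open import Data.Fin using (Fin; _≟_)
import Data.Fin as F
open import Data.Fin.Subset using (Subset; _∈_; ∣_∣)
open import Data.Vec using (lookup)
open import Data.List using (List; allFin; map)
open import Data.Nat.ListAction using (sum)
open import Data.Product using (_×_; ∃-syntax)
open import Relation.Binary.PropositionalEquality using (_≡_; _≢_)
open import Relation.Nullary.Decidable using (⌊_⌋)

Graph : ℕ → Set
Graph n = Fin n → Fin n → Bool

IsSimple : {n : ℕ} → Graph n → Set
IsSimple {n} G = (∀ (i : Fin n) → G i i ≡ false) × (∀ (i j : Fin n) → G i j ≡ G j i)

count : {n : ℕ} → (Fin n → Bool) → ℕ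
count {n} p = sum (map (λ i → if p i then 1 else 0) (allFin n))

iH : {n : ℕ} → Graph n → Subset n → ℕ
iH {n} H X = sum (map (λ i → count (λ j →
  ⌊ i F.<? j ⌋ ∧ lookup X i ∧ lookup X j ∧ H i j)) (allFin n))

Sparse : {n : ℕ} → ℕ → Graph n → Set
Sparse {n} k H = ∀ (X : Subset n) → 3 ≤ ∣ X ∣ → iH H X ≤ k * ∣ X ∣ ∸ 2 * k

addEdge : {n : ℕ} → Graph n → Fin n → Fin n → Graph n
addEdge G u v i j = G i j ∨ (⌊ i ≟ u ⌋ ∧ ⌊ j ≟ v ⌋) ∨ (⌊ i ≟ v ⌋ ∧ ⌊ j ≟ u ⌋)

-- A directed graph on Fin n: D i j ≡ true means there is an arc from i to j.
Digraph : ℕ → Set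
Digraph n = Fin n → Fin n → Bool

IsOrientation : {n : ℕ} → Digraph n → Graph n → Set
IsOrientation {n} D G =
  (∀ (i j : Fin n) → D i j ≡ true → G i j ≡ true) ×
  (∀ (i j : Fin n) → G i j ≡ true → (D i j ≡ true) Data.Sum.⊎ (D j i ≡ true)) ×
  (∀ (i j : Fin n) → D i j ≡ true → D j i ≡ false)
  where import Data.Sum

indeg : {n : ℕ} → Digraph n → Fin n → ℕ
indeg D w = count (λ i → D i w)

data Path {n : ℕ} (D : Digraph n) : Fin n → Fin n → Set where
  here : ∀ {x} → Path D x x
  step : ∀ {x y w} → D x y ≡ true → Path D y w → Path D x w

{-# OPTIONS --safe #-}
module Submission where

-- Counting each edge at its head in D, i_G(X) is the sum over j ∈ X of the number of
-- in-neighbours of j inside X, and i_{G+uv}(X) = i_G(X) + 1 when u, v ∈ X (otherwise the edge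
-- uv does not matter).  Since u and v receive no arcs and all indegrees are at most k, such an X
-- has i_{G+uv}(X) ≤ k|X| - 2k + 1, so it violates sparsity exactly when every node of X ∖ {u,v}
-- has all of its k in-neighbours in X.  In that case X is closed under predecessors and
-- X ∖ {u,v} contains no deficient node (indegree below k), so no node of X ∖ {u,v} is reachable
-- from a deficient node.  Conversely, if w is not reachable from a deficient node, the ancestors
-- of w together with u and v form a violating X.

open import Defs
open import Algebra.Bundles using (CommutativeMonoid)
open import Data.Bool using (Bool; true; false; _∧_; _∨_; not; if_then_else_)
import Data.Bool.Properties as Bool
open import Data.Fin using (Fin; zero; suc; _≟_; _<?_)
import Data.Fin as Fin
open import Data.Fin.Properties using (suc-injective; any?; <-cmp; <-asym; <-irrefl)
open import Data.Fin.Subset using (Subset; ∣_∣)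
import Data.List as List
open import Data.List.Properties using (map-tabulate)
open import Data.Nat using (ℕ; zero; suc; _+_; _*_; _∸_; _≤_; _<_; z≤n; s≤s)
import Data.Nat as ℕ
import Data.Nat.ListAction as ListAction
open import Data.Nat.Properties
  using ( +-*-semiring; ≤-refl; ≤-reflexive; ≤-trans; ≤-<-trans; n≤0⇒n≡0; <⇒≱; ≤⇒≯; ≮⇒≥
        ; +-comm; +-identityʳ; *-comm; *-distribˡ-+; *-cancelˡ-≡; m+n∸n≡m; m<m+n
        ; +-mono-≤; +-mono-<-≤; +-mono-≤-<; +-monoˡ-≤; +-cancelʳ-≤; module ≤-Reasoning )
open import Data.Product using (∃; ∃-syntax; _×_; _,_; proj₁; proj₂)
open import Data.Sum using (_⊎_; inj₁; inj₂)
open import Data.Vec using ([]; _∷_; lookup; tabulate)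
open import Data.Vec.Properties using (lookup∘tabulate)
open import Function using (_∘_; id)
open import Function.Bundles using (_⇔_; mk⇔)
open import Relation.Binary.Definitions using (Tri; tri<; tri≈; tri>)
open import Relation.Binary.PropositionalEquality
  using (_≡_; _≢_; refl; sym; trans; cong; cong₂; subst; subst₂; module ≡-Reasoning)
open import Relation.Nullary using (Dec; does; ¬_; ¬?; yes; no; contradiction; _⊎-dec_; _×-dec_)
open import Relation.Nullary.Decidable using (⌊_⌋; isYes≗does; dec-true; dec-false)

open import Algebra.Properties.Semiring.Sum +-*-semiring
  using (sum; sum-syntax; sum-cong-≗; sum-replicate-zero; ∑-distrib-+; ∑-comm; *-distribʳ-sum)
open import Algebra.Properties.CommutativeSemigroup
  (CommutativeMonoid.commutativeSemigroup Bool.∧-commutativeMonoid)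
  using () renaming (x∙yz≈y∙xz to x∧yz≡y∧xz)

private variable n : ℕ

-- Finite sums and counting

𝟙 : Bool → ℕ
𝟙 b = if b then 1 else 0

𝟙-mono : ∀ {a b} → (a ≡ true → b ≡ true) → 𝟙 a ≤ 𝟙 b
𝟙-mono {false} _ = z≤n
𝟙-mono {true} a⇒b rewrite a⇒b refl = ≤-refl

𝟙≤1 : ∀ b → 𝟙 b ≤ 1
𝟙≤1 false = z≤n
𝟙≤1 true = ≤-refl

𝟙-∨ : ∀ g e → g ∧ e ≡ false → 𝟙 (g ∨ e) ≡ 𝟙 g + 𝟙 e
𝟙-∨ false _ _ = refl
𝟙-∨ true false _ = refl

𝟙-∧-+ : ∀ x {b c d} → 𝟙 b ≡ 𝟙 c + 𝟙 d → 𝟙 (x ∧ b) ≡ 𝟙 (x ∧ c) + 𝟙 (x ∧ d)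
𝟙-∧-+ false _ = refl
𝟙-∧-+ true eq = eq

⌊⌋-true : ∀ {a} {A : Set a} (d : Dec A) → A → ⌊ d ⌋ ≡ true
⌊⌋-true d a = trans (isYes≗does d) (dec-true d a)

⌊⌋-false : ∀ {a} {A : Set a} (d : Dec A) → ¬ A → ⌊ d ⌋ ≡ false
⌊⌋-false d ¬a = trans (isYes≗does d) (dec-false d ¬a)

≟-sound : ∀ {i j : Fin n} → ⌊ i ≟ j ⌋ ≡ true → i ≡ j
≟-sound {i = i} {j} eq with i ≟ j
... | yes i≡j = i≡j

does⇒ : ∀ {a} {A : Set a} (d : Dec A) → does d ≡ true → A
does⇒ (yes a) _ = a

∑-mono-≤ : ∀ {n} {f g : Fin n → ℕ} → (∀ i → f i ≤ g i) → sum f ≤ sum g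
∑-mono-≤ {zero} _ = z≤n
∑-mono-≤ {suc n} f≤g = +-mono-≤ (f≤g zero) (∑-mono-≤ (f≤g ∘ suc))

∑-mono-< : ∀ {n} {f g : Fin n → ℕ} → (∀ i → f i ≤ g i) → ∀ a → f a < g a → sum f < sum g
∑-mono-< f≤g zero fa<ga = +-mono-<-≤ fa<ga (∑-mono-≤ (f≤g ∘ suc))
∑-mono-< f≤g (suc a) fa<ga = +-mono-≤-< (f≤g zero) (∑-mono-< (f≤g ∘ suc) a fa<ga)

∑-supported-at : ∀ {n} (f : Fin n → ℕ) b → (∀ j → j ≢ b → f j ≡ 0) → sum f ≡ f b
∑-supported-at {suc n} f zero vanish = begin
  f zero + ∑[ j < n ] f (suc j)  ≡⟨ cong (f zero +_) (sum-cong-≗ (λ j → vanish (suc j) λ ())) ⟩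
  f zero + ∑[ j < n ] 0          ≡⟨ cong (f zero +_) (sum-replicate-zero n) ⟩
  f zero + 0                     ≡⟨ +-identityʳ (f zero) ⟩
  f zero                         ∎
  where open ≡-Reasoning
∑-supported-at {suc n} f (suc b) vanish rewrite vanish zero λ () =
  ∑-supported-at (f ∘ suc) b (λ j j≢b → vanish (suc j) (j≢b ∘ suc-injective))

∑𝟙-supported-at : ∀ {n} (p : Fin n → Bool) b → (∀ j → p j ≡ true → j ≡ b) → ∑[ j < n ] 𝟙 (p j) ≡ 𝟙 (p b)
∑𝟙-supported-at p b supp = ∑-supported-at (𝟙 ∘ p) b vanish
  where
  vanish : ∀ j → j ≢ b → 𝟙 (p j) ≡ 0
  vanish j j≢b with p j in pj
  ... | true = contradiction (supp j pj) j≢b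
  ... | false = refl

∑𝟙-≟ : ∀ {n} (a : Fin n) → ∑[ j < n ] 𝟙 ⌊ j ≟ a ⌋ ≡ 1
∑𝟙-≟ a = trans (∑𝟙-supported-at (λ j → ⌊ j ≟ a ⌋) a (λ j → ≟-sound)) (cong 𝟙 (⌊⌋-true (a ≟ a) refl))

∑∑-symmetrise : ∀ {n} (f : Fin n → Fin n → ℕ) →
  ∑[ i < n ] ∑[ j < n ] (f i j + f j i) ≡ 2 * ∑[ i < n ] ∑[ j < n ] f i j
∑∑-symmetrise {n} f = begin
  ∑[ i < n ] ∑[ j < n ] (f i j + f j i)             ≡⟨ sum-cong-≗ (λ i → ∑-distrib-+ (f i) (λ j → f j i)) ⟩
  ∑[ i < n ] (∑[ j < n ] f i j + ∑[ j < n ] f j i)  ≡⟨ ∑-distrib-+ (λ i → ∑[ j < n ] f i j) (λ i → ∑[ j < n ] f j i) ⟩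
  S + ∑[ i < n ] ∑[ j < n ] f j i                   ≡⟨ cong (S +_) (∑-comm (λ i j → f j i)) ⟩
  S + S                                             ≡⟨ cong (S +_) (+-identityʳ S) ⟨
  2 * S                                             ∎
  where
  open ≡-Reasoning
  S = ∑[ i < n ] ∑[ j < n ] f i j

sum-map-allFin : ∀ {n} (f : Fin n → ℕ) → ListAction.sum (List.map f (List.allFin n)) ≡ sum f
sum-map-allFin f = trans (cong ListAction.sum (map-tabulate id f)) (sum-tabulate f)
  where
  sum-tabulate : ∀ {n} (f : Fin n → ℕ) → ListAction.sum (List.tabulate f) ≡ sum f
  sum-tabulate {zero} f = refl
  sum-tabulate {suc n} f = cong (f zero +_) (sum-tabulate (f ∘ suc))

count≡∑ : ∀ {n} (p : Fin n → Bool) → count p ≡ ∑[ i < n ] 𝟙 (p i)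
count≡∑ p = sum-map-allFin (𝟙 ∘ p)

∣X∣≡count : (X : Subset n) → ∣ X ∣ ≡ count (lookup X)
∣X∣≡count X = trans (card X) (sym (count≡∑ (lookup X)))
  where
  card : ∀ {n} (X : Subset n) → ∣ X ∣ ≡ ∑[ i < n ] 𝟙 (lookup X i)
  card [] = refl
  card (true ∷ X) = cong suc (card X)
  card (false ∷ X) = card X

count-mono : ∀ {p q : Fin n → Bool} → (∀ i → p i ≡ true → q i ≡ true) → count p ≤ count q
count-mono {p = p} {q} p⊆q =
  subst₂ _≤_ (sym (count≡∑ p)) (sym (count≡∑ q)) (∑-mono-≤ (λ i → 𝟙-mono (p⊆q i)))

count-< : ∀ {p q : Fin n → Bool} → (∀ i → p i ≡ true → q i ≡ true) →
          ∀ a → p a ≡ false → q a ≡ true → count p < count q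
count-< {p = p} {q} p⊆q a pa qa =
  subst₂ _<_ (sym (count≡∑ p)) (sym (count≡∑ q)) (∑-mono-< (λ i → 𝟙-mono (p⊆q i)) a strict)
  where
  strict : 𝟙 (p a) < 𝟙 (q a)
  strict rewrite pa | qa = ≤-refl

count≤n : ∀ {n} (p : Fin n → Bool) → count p ≤ n
count≤n {n} p = subst (_≤ n) (sym (count≡∑ p)) (bound n p)
  where
  bound : ∀ n (p : Fin n → Bool) → ∑[ i < n ] 𝟙 (p i) ≤ n
  bound zero p = z≤n
  bound (suc n) p = +-mono-≤ (𝟙≤1 (p zero)) (bound n (p ∘ suc))

count-empty : count {n} (λ _ → false) ≡ 0
count-empty {n} = trans (count≡∑ {n} _) (sum-replicate-zero n)

count-pos : ∀ {p : Fin n → Bool} a → p a ≡ true → 0 < count p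
count-pos {n} {p} a pa = subst (_< count p) (count-empty {n}) (count-< {p = λ _ → false} (λ _ ()) a refl pa)

count≡0 : ∀ {p : Fin n → Bool} → count p ≡ 0 → ∀ i → p i ≡ false
count≡0 {p = p} c≡0 i with p i in pi
... | false = refl
... | true = contradiction (subst (0 <_) c≡0 (count-pos i pi)) λ ()

count>0 : ∀ {p : Fin n → Bool} → 0 < count p → ∃ λ i → p i ≡ true
count>0 {n} {p} 0<c with any? (λ i → p i Bool.≟ true)
... | yes found = found
... | no none = contradiction (subst (0 <_) (count-empty {n})
    (≤-trans 0<c (count-mono {q = λ _ → false} (λ i pi → contradiction (i , pi) none)))) λ ()

∑-𝟙*-count : ∀ {n} (p : Fin n → Bool) m → ∑[ i < n ] (𝟙 (p i) * m) ≡ count p * m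
∑-𝟙*-count p m = sym (trans (cong (_* m) (count≡∑ p)) (*-distribʳ-sum m (𝟙 ∘ p)))

∑<count* : ∀ {n} {f : Fin n → ℕ} {p : Fin n → Bool} {m} →
  (∀ j → p j ≡ false → f j ≡ 0) → (∀ j → f j ≤ m) →
  ∀ a → p a ≡ true → f a < m → sum f < count p * m
∑<count* {f = f} {p} {m} outside≡0 ≤m a pa fa<m =
  subst (sum f <_) (∑-𝟙*-count p m) (∑-mono-< bound a strict)
  where
  bound : ∀ j → f j ≤ 𝟙 (p j) * m
  bound j with p j in pj
  ... | true = ≤-trans (≤m j) (≤-reflexive (sym (+-identityʳ m)))
  ... | false = ≤-reflexive (outside≡0 j pj)
  strict : f a < 𝟙 (p a) * m
  strict rewrite pa = ≤-trans fa<m (≤-reflexive (sym (+-identityʳ m)))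

count*≤∑ : ∀ {n} {f : Fin n → ℕ} {p : Fin n → Bool} {m} →
  (∀ j → p j ≡ true → m ≤ f j) → count p * m ≤ sum f
count*≤∑ {f = f} {p} {m} inside≥m = subst (_≤ sum f) (∑-𝟙*-count p m) (∑-mono-≤ bound)
  where
  bound : ∀ j → 𝟙 (p j) * m ≤ f j
  bound j with p j in pj
  ... | true = ≤-trans (≤-reflexive (+-identityʳ m)) (inside≥m j pj)
  ... | false = z≤n

removePair : (Fin n → Bool) → Fin n → Fin n → Fin n → Bool
removePair p u v j = p j ∧ not ⌊ j ≟ u ⌋ ∧ not ⌊ j ≟ v ⌋

removePair-sound : ∀ {p : Fin n → Bool} {u v j} → removePair p u v j ≡ true → p j ≡ true × j ≢ u × j ≢ v
removePair-sound {p = p} {u} {v} {j} eq with p j | j ≟ u | j ≟ v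
... | true | no j≢u | no j≢v = refl , j≢u , j≢v

removePair-complement : ∀ {p : Fin n → Bool} {u v j} → removePair p u v j ≡ false → p j ≡ false ⊎ j ≡ u ⊎ j ≡ v
removePair-complement {p = p} {u} {v} {j} eq with p j | j ≟ u | j ≟ v
... | false | _ | _ = inj₁ refl
... | true | yes j≡u | _ = inj₂ (inj₁ j≡u)
... | true | no _ | yes j≡v = inj₂ (inj₂ j≡v)

removePair-intro : ∀ {p : Fin n → Bool} {u v j} → p j ≡ true → j ≢ u → j ≢ v → removePair p u v j ≡ true
removePair-intro {u = u} {v} {j} pj j≢u j≢v rewrite pj | ⌊⌋-false (j ≟ u) j≢u | ⌊⌋-false (j ≟ v) j≢v = refl

count-removePair : ∀ {n} {p : Fin n → Bool} {u v} → u ≢ v → p u ≡ true → p v ≡ true →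
  count p ≡ count (removePair p u v) + 2
count-removePair {n} {p} {u} {v} u≢v pu pv = begin
  count p                                                          ≡⟨ count≡∑ p ⟩
  ∑[ j < n ] 𝟙 (p j)                                               ≡⟨ sum-cong-≗ split ⟩
  ∑[ j < n ] (𝟙 (removePair p u v j) + (𝟙 ⌊ j ≟ u ⌋ + 𝟙 ⌊ j ≟ v ⌋))  ≡⟨ ∑-distrib-+ (𝟙 ∘ removePair p u v) _ ⟩
  ∑[ j < n ] 𝟙 (removePair p u v j) + ∑[ j < n ] (𝟙 ⌊ j ≟ u ⌋ + 𝟙 ⌊ j ≟ v ⌋)
    ≡⟨ cong₂ _+_ (sym (count≡∑ (removePair p u v)))
                 (trans (∑-distrib-+ (λ j → 𝟙 ⌊ j ≟ u ⌋) (λ j → 𝟙 ⌊ j ≟ v ⌋)) (cong₂ _+_ (∑𝟙-≟ u) (∑𝟙-≟ v))) ⟩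
  count (removePair p u v) + 2                                     ∎
  where
  open ≡-Reasoning
  split : ∀ j → 𝟙 (p j) ≡ 𝟙 (removePair p u v j) + (𝟙 ⌊ j ≟ u ⌋ + 𝟙 ⌊ j ≟ v ⌋)
  split j with j ≟ u | j ≟ v
  ... | yes refl | yes u≡v = contradiction u≡v u≢v
  ... | yes refl | no _ rewrite pu = refl
  ... | no _ | yes refl rewrite pv = refl
  ... | no _ | no _ with p j
  ...   | true = refl
  ...   | false = refl

-- Edges inside a node set

iH≡∑∑ : ∀ {n} (H : Graph n) (X : Subset n) →
  iH H X ≡ ∑[ i < n ] ∑[ j < n ] 𝟙 (⌊ i <? j ⌋ ∧ lookup X i ∧ lookup X j ∧ H i j)
iH≡∑∑ {n} H X = trans (sum-map-allFin (count ∘ edgeFrom)) (sum-cong-≗ (count≡∑ ∘ edgeFrom))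
  where
  edgeFrom : Fin n → Fin n → Bool
  edgeFrom i j = ⌊ i <? j ⌋ ∧ lookup X i ∧ lookup X j ∧ H i j

iH-∪ : ∀ {n} {H₁ H₂ : Graph n} (X : Subset n) → (∀ i j → H₁ i j ∧ H₂ i j ≡ false) →
  iH (λ i j → H₁ i j ∨ H₂ i j) X ≡ iH H₁ X + iH H₂ X
iH-∪ {n} {H₁} {H₂} X disjoint = begin
  iH (λ i j → H₁ i j ∨ H₂ i j) X
    ≡⟨ iH≡∑∑ _ X ⟩
  ∑[ i < n ] ∑[ j < n ] 𝟙 (⌊ i <? j ⌋ ∧ lookup X i ∧ lookup X j ∧ (H₁ i j ∨ H₂ i j))
    ≡⟨ sum-cong-≗ (λ i → trans (sum-cong-≗ (split i)) (∑-distrib-+ (term H₁ i) (term H₂ i))) ⟩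
  ∑[ i < n ] (∑[ j < n ] term H₁ i j + ∑[ j < n ] term H₂ i j)
    ≡⟨ ∑-distrib-+ (λ i → ∑[ j < n ] term H₁ i j) (λ i → ∑[ j < n ] term H₂ i j) ⟩
  ∑[ i < n ] ∑[ j < n ] term H₁ i j + ∑[ i < n ] ∑[ j < n ] term H₂ i j
    ≡⟨ cong₂ _+_ (iH≡∑∑ H₁ X) (iH≡∑∑ H₂ X) ⟨
  iH H₁ X + iH H₂ X
    ∎
  where
  open ≡-Reasoning
  term : Graph n → Fin n → Fin n → ℕ
  term H i j = 𝟙 (⌊ i <? j ⌋ ∧ lookup X i ∧ lookup X j ∧ H i j)
  split : ∀ i j → 𝟙 (⌊ i <? j ⌋ ∧ lookup X i ∧ lookup X j ∧ (H₁ i j ∨ H₂ i j)) ≡ term H₁ i j + term H₂ i j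
  split i j = 𝟙-∧-+ ⌊ i <? j ⌋ (𝟙-∧-+ (lookup X i) (𝟙-∧-+ (lookup X j) (𝟙-∨ (H₁ i j) (H₂ i j) (disjoint i j))))

arc : Fin n → Fin n → Graph n
arc a b i j = ⌊ i ≟ a ⌋ ∧ ⌊ j ≟ b ⌋

arc-sound : ∀ (a b i j : Fin n) → arc a b i j ≡ true → i ≡ a × j ≡ b
arc-sound a b i j eq = ≟-sound (Bool.∧-conicalˡ _ _ eq) , ≟-sound (Bool.∧-conicalʳ ⌊ i ≟ a ⌋ _ eq)

edge : Fin n → Fin n → Graph n
edge u v i j = arc u v i j ∨ arc v u i j

iH-arc : ∀ {n} (X : Subset n) (a b : Fin n) → iH (arc a b) X ≡ 𝟙 (⌊ a <? b ⌋ ∧ lookup X a ∧ lookup X b)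
iH-arc {n} X a b = begin
  iH (arc a b) X                             ≡⟨ iH≡∑∑ (arc a b) X ⟩
  ∑[ i < n ] ∑[ j < n ] 𝟙 (p i j)            ≡⟨ sum-cong-≗ (λ i → ∑𝟙-supported-at (p i) b (λ j → proj₂ ∘ on-arc i j)) ⟩
  ∑[ i < n ] 𝟙 (p i b)                       ≡⟨ ∑𝟙-supported-at (λ i → p i b) a (λ i → proj₁ ∘ on-arc i b) ⟩
  𝟙 (p a b)                                  ≡⟨ cong 𝟙 at-arc ⟩
  𝟙 (⌊ a <? b ⌋ ∧ lookup X a ∧ lookup X b)  ∎
  where
  open ≡-Reasoning
  p : Fin n → Fin n → Bool
  p i j = ⌊ i <? j ⌋ ∧ lookup X i ∧ lookup X j ∧ arc a b i j
  on-arc : ∀ i j → p i j ≡ true → i ≡ a × j ≡ b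
  on-arc i j = arc-sound a b i j ∘ last-conjunct ⌊ i <? j ⌋ (lookup X i) (lookup X j)
    where
    last-conjunct : ∀ x y z {e} → x ∧ y ∧ z ∧ e ≡ true → e ≡ true
    last-conjunct true true true eq = eq
  at-arc : p a b ≡ ⌊ a <? b ⌋ ∧ lookup X a ∧ lookup X b
  at-arc rewrite ⌊⌋-true (a ≟ a) refl | ⌊⌋-true (b ≟ b) refl | Bool.∧-identityʳ (lookup X b) = refl

iH-edge : ∀ {n} (X : Subset n) {u v : Fin n} → u ≢ v → iH (edge u v) X ≡ 𝟙 (lookup X u ∧ lookup X v)
iH-edge X {u} {v} u≢v = begin
  iH (edge u v) X                  ≡⟨ iH-∪ X arcs-disjoint ⟩
  iH (arc u v) X + iH (arc v u) X  ≡⟨ cong₂ _+_ (iH-arc X u v) (iH-arc X v u) ⟩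
  𝟙 (⌊ u <? v ⌋ ∧ lookup X u ∧ lookup X v) + 𝟙 (⌊ v <? u ⌋ ∧ lookup X v ∧ lookup X u)
                                   ≡⟨ one-direction (<-cmp u v) ⟩
  𝟙 (lookup X u ∧ lookup X v)      ∎
  where
  open ≡-Reasoning
  arcs-disjoint : ∀ i j → arc u v i j ∧ arc v u i j ≡ false
  arcs-disjoint i j with arc u v i j in uv
  ... | false = refl
  ... | true with arc-sound u v i j uv
  ...   | refl , refl rewrite ⌊⌋-false (u ≟ v) u≢v = refl
  one-direction : Tri (u Fin.< v) (u ≡ v) (v Fin.< u) →
    𝟙 (⌊ u <? v ⌋ ∧ lookup X u ∧ lookup X v) + 𝟙 (⌊ v <? u ⌋ ∧ lookup X v ∧ lookup X u) ≡
    𝟙 (lookup X u ∧ lookup X v)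
  one-direction (tri< u<v _ _) rewrite ⌊⌋-true (u <? v) u<v | ⌊⌋-false (v <? u) (<-asym u<v) = +-identityʳ _
  one-direction (tri≈ _ u≡v _) = contradiction u≡v u≢v
  one-direction (tri> _ _ v<u) rewrite ⌊⌋-false (u <? v) (<-asym v<u) | ⌊⌋-true (v <? u) v<u =
    cong 𝟙 (Bool.∧-comm (lookup X v) (lookup X u))

iH-addEdge : ∀ {n} {G : Graph n} {u v : Fin n} (X : Subset n) → IsSimple G → G u v ≡ false → u ≢ v →
  iH (addEdge G u v) X ≡ iH G X + 𝟙 (lookup X u ∧ lookup X v)
iH-addEdge {G = G} {u} {v} X simple Guv u≢v = trans (iH-∪ X new-edge) (cong (iH G X +_) (iH-edge X u≢v))
  where
  new-edge : ∀ i j → G i j ∧ edge u v i j ≡ false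
  new-edge i j with G i j in gij | arc u v i j in uv | arc v u i j in vu
  ... | false | _ | _ = refl
  ... | true | false | false = refl
  ... | true | true | _ with arc-sound u v i j uv
  ...   | refl , refl = contradiction (trans (sym gij) Guv) λ ()
  new-edge i j | true | false | true with arc-sound v u i j vu
  ...   | refl , refl = contradiction (trans (sym gij) (trans (proj₂ simple v u) Guv)) λ ()

indegIn : Digraph n → Subset n → Fin n → ℕ
indegIn D X j = count (λ i → lookup X i ∧ lookup X j ∧ D i j)

arcsIn : Digraph n → Subset n → ℕ
arcsIn {n} D X = ∑[ j < n ] indegIn D X j

module _ {H : Graph n} {D : Digraph n} (simple : IsSimple H) (orient : IsOrientation D H) where

  orientation-loopless : ∀ i → D i i ≡ false
  orientation-loopless i with D i i in dii
  ... | false = refl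
  ... | true = trans (sym (proj₁ orient i i dii)) (proj₁ simple i)

  orientation-cover : ∀ i j → H i j ≡ D i j ∨ D j i
  orientation-cover i j with D i j in dij | D j i in dji
  ... | true | _ = proj₁ orient i j dij
  ... | false | true = trans (proj₂ simple i j) (proj₁ orient j i dji)
  ... | false | false with H i j in hij
  ...   | false = refl
  ...   | true with proj₁ (proj₂ orient) i j hij
  ...     | inj₁ d = trans (sym d) dij
  ...     | inj₂ d = trans (sym d) dji

  orientation-disjoint : ∀ i j → D i j ∧ D j i ≡ false
  orientation-disjoint i j with D i j in dij
  ... | false = refl
  ... | true = proj₂ (proj₂ orient) i j dij

  -- Taken together, the ordered pairs (i, j) and (j, i) count an edge ij of H[X] once on
  -- each side: on the left through the smaller endpoint, on the right through the head of its arc.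
  iH≡arcsIn : (X : Subset n) → iH H X ≡ arcsIn D X
  iH≡arcsIn X = *-cancelˡ-≡ _ _ 2 (begin
    2 * iH H X                             ≡⟨ cong (2 *_) (iH≡∑∑ H X) ⟩
    2 * ∑[ i < n ] ∑[ j < n ] L i j        ≡⟨ ∑∑-symmetrise L ⟨
    ∑[ i < n ] ∑[ j < n ] (L i j + L j i)  ≡⟨ sum-cong-≗ (λ i → sum-cong-≗ (pair i)) ⟩
    ∑[ i < n ] ∑[ j < n ] (A i j + A j i)  ≡⟨ ∑∑-symmetrise A ⟩
    2 * ∑[ i < n ] ∑[ j < n ] A i j        ≡⟨ cong (2 *_) (∑-comm A) ⟩
    2 * ∑[ j < n ] ∑[ i < n ] A i j        ≡⟨ cong (2 *_) (sum-cong-≗ (count≡∑ ∘ arcInto)) ⟨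
    2 * arcsIn D X                         ∎)
    where
    open ≡-Reasoning
    L A : Fin n → Fin n → ℕ
    L i j = 𝟙 (⌊ i <? j ⌋ ∧ lookup X i ∧ lookup X j ∧ H i j)
    A i j = 𝟙 (lookup X i ∧ lookup X j ∧ D i j)
    arcInto : Fin n → Fin n → Bool
    arcInto j i = lookup X i ∧ lookup X j ∧ D i j
    ordered : ∀ {i j} → i Fin.< j → L i j + L j i ≡ A i j + A j i
    ordered {i} {j} i<j rewrite ⌊⌋-true (i <? j) i<j | ⌊⌋-false (j <? i) (<-asym i<j) = begin
      𝟙 (lookup X i ∧ lookup X j ∧ H i j) + 0
        ≡⟨ +-identityʳ _ ⟩
      𝟙 (lookup X i ∧ lookup X j ∧ H i j)
        ≡⟨ cong (λ h → 𝟙 (lookup X i ∧ lookup X j ∧ h)) (orientation-cover i j) ⟩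
      𝟙 (lookup X i ∧ lookup X j ∧ (D i j ∨ D j i))
        ≡⟨ 𝟙-∧-+ (lookup X i) (𝟙-∧-+ (lookup X j) (𝟙-∨ (D i j) (D j i) (orientation-disjoint i j))) ⟩
      A i j + 𝟙 (lookup X i ∧ lookup X j ∧ D j i)
        ≡⟨ cong (λ x → A i j + 𝟙 x) (x∧yz≡y∧xz (lookup X i) (lookup X j) (D j i)) ⟩
      A i j + A j i
        ∎
    pair : ∀ i j → L i j + L j i ≡ A i j + A j i
    pair i j with <-cmp i j
    ... | tri< i<j _ _ = ordered i<j
    ... | tri> _ _ j<i = trans (+-comm (L i j) (L j i)) (trans (ordered j<i) (+-comm (A j i) (A i j)))
    ... | tri≈ _ refl _ rewrite ⌊⌋-false (i <? i) (<-irrefl refl) | orientation-loopless i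
                              | Bool.∧-zeroʳ (lookup X i) | Bool.∧-zeroʳ (lookup X i) = refl

module _ (D : Digraph n) (X : Subset n) where

  private
    arcInto : Fin n → Fin n → Bool
    arcInto j i = lookup X i ∧ lookup X j ∧ D i j

    arcInto⇒arc : ∀ j i → arcInto j i ≡ true → D i j ≡ true
    arcInto⇒arc j i e = Bool.∧-conicalʳ (lookup X j) _ (Bool.∧-conicalʳ (lookup X i) _ e)

  indegIn≤indeg : ∀ j → indegIn D X j ≤ indeg D j
  indegIn≤indeg j = count-mono {p = arcInto j} (arcInto⇒arc j)

  indegIn-outside : ∀ {j} → lookup X j ≡ false → indegIn D X j ≡ 0
  indegIn-outside {j} Xj =
    n≤0⇒n≡0 (subst (indegIn D X j ≤_) (count-empty {n}) (count-mono {p = arcInto j} {q = λ _ → false} head∈X))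
    where
    head∈X : ∀ i → arcInto j i ≡ true → false ≡ true
    head∈X i e = trans (sym Xj) (Bool.∧-conicalˡ (lookup X j) _ (Bool.∧-conicalʳ (lookup X i) _ e))

  indegIn-full : ∀ {j} → lookup X j ≡ true → (∀ {i} → D i j ≡ true → lookup X i ≡ true) →
    indeg D j ≤ indegIn D X j
  indegIn-full {j} Xj preds∈X = count-mono {q = arcInto j} λ i dij →
    subst₂ (λ x y → x ∧ y ∧ D i j ≡ true) (sym (preds∈X dij)) (sym Xj) dij

  indegIn-full⇒preds∈X : ∀ {i j} → indeg D j ≤ indegIn D X j → D i j ≡ true → lookup X i ≡ true
  indegIn-full⇒preds∈X {i} {j} full dij with lookup X i in Xi
  ... | true = refl
  ... | false = contradiction full (<⇒≱ (count-< {p = arcInto j} (arcInto⇒arc j) i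
                  (cong (_∧ (lookup X j ∧ D i j)) Xi) dij))

no-arc-into : ∀ (D : Digraph n) {x} → indeg D x ≡ 0 → ∀ {i j} → D i j ≡ true → j ≢ x
no-arc-into D indeg≡0 {i} dij refl = contradiction (trans (sym dij) (count≡0 indeg≡0 i)) λ ()

-- Ancestor sets

PredClosed : Digraph n → (Fin n → Bool) → Set
PredClosed D R = ∀ {i j} → D i j ≡ true → R j ≡ true → R i ≡ true

Path-closed : ∀ {D : Digraph n} {R} → PredClosed D R → ∀ {z w} → Path D z w → R w ≡ true → R z ≡ true
Path-closed closed here Rw = Rw
Path-closed closed (step d p) Rw = closed d (Path-closed closed p Rw)

record Ancestors (D : Digraph n) (w : Fin n) : Set where
  field
    member : Fin n → Bool
    target : member w ≡ true
    sound  : ∀ {y} → member y ≡ true → Path D y w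
    closed : PredClosed D member

module _ (D : Digraph n) (w : Fin n) where

  Within : ℕ → Fin n → Set
  Within zero y = y ≡ w
  Within (suc m) y = Within m y ⊎ ∃ λ j → D y j ≡ true × Within m j

  within? : ∀ m y → Dec (Within m y)
  within? zero y = y ≟ w
  within? (suc m) y = within? m y ⊎-dec any? (λ j → (D y j Bool.≟ true) ×-dec within? m j)

  within : ℕ → Fin n → Bool
  within m y = does (within? m y)

  Within-sound : ∀ m {y} → Within m y → Path D y w
  Within-sound zero refl = here
  Within-sound (suc m) (inj₁ p) = Within-sound m p
  Within-sound (suc m) (inj₂ (j , d , p)) = step d (Within-sound m p)

  Within-target : ∀ m → Within m w
  Within-target zero = refl
  Within-target (suc m) = inj₁ (Within-target m)

  within-closed-or-grows : ∀ m → PredClosed D (within m) ⊎ count (within m) < count (within (suc m))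
  within-closed-or-grows m with any? (λ i → any? (λ j →
      (D i j Bool.≟ true) ×-dec (within m j Bool.≟ true) ×-dec (within m i Bool.≟ false)))
  ... | yes (i , j , dij , mj , ¬mi) = inj₂ (count-< within-mono i ¬mi
          (dec-true (within? (suc m) i) (inj₂ (j , dij , does⇒ (within? m j) mj))))
    where
    within-mono : ∀ y → within m y ≡ true → within (suc m) y ≡ true
    within-mono y my = dec-true (within? (suc m) y) (inj₁ (does⇒ (within? m y) my))
  ... | no none = inj₁ closed
    where
    closed : PredClosed D (within m)
    closed {i} {j} dij mj with within m i in mi
    ... | true = refl
    ... | false = contradiction (i , j , dij , mj , mi) none

  within-stabilises : ∀ m → (∃ λ l → PredClosed D (within l)) ⊎ m ≤ count (within m)
  within-stabilises zero = inj₂ z≤n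
  within-stabilises (suc m) with within-stabilises m | within-closed-or-grows m
  ... | inj₁ closed | _ = inj₁ closed
  ... | inj₂ _ | inj₁ closed = inj₁ (m , closed)
  ... | inj₂ m≤c | inj₂ c<c′ = inj₂ (≤-<-trans m≤c c<c′)

  -- A round that is not closed under predecessors adds a node, so one of the first n rounds is.
  ancestors : Ancestors D w
  ancestors with within-stabilises (suc n)
  ... | inj₂ n<c = contradiction (count≤n _) (<⇒≱ n<c)
  ... | inj₁ (l , closed) = record
    { member = within l
    ; target = dec-true (within? l w) (Within-target l)
    ; sound  = λ {y} my → Within-sound l (does⇒ (within? l y) my)
    ; closed = closed
    }

-- Adding the edge uv

module Augmentation {n k : ℕ} {G : Graph n} {D : Digraph n} {u v : Fin n}
    (simple : IsSimple G) (orient : IsOrientation D G) (indeg≤k : ∀ x → indeg D x ≤ k)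
    (indeg-u : indeg D u ≡ 0) (indeg-v : indeg D v ≡ 0) (u≢v : u ≢ v) (Guv : G u v ≡ false) where

  ReachableFromDeficient : Fin n → Set
  ReachableFromDeficient w = ∃[ z ] (z ≢ u × z ≢ v × indeg D z < k × Path D z w)

  AllReachableFromDeficient : Set
  AllReachableFromDeficient = ∀ w → w ≢ u → w ≢ v → ReachableFromDeficient w

  Inner : Subset n → Fin n → Bool
  Inner X = removePair (lookup X) u v

  indegIn-outer : ∀ X j → Inner X j ≡ false → indegIn D X j ≡ 0
  indegIn-outer X j outer with removePair-complement {p = lookup X} outer
  ... | inj₁ Xj = indegIn-outside D X Xj
  ... | inj₂ (inj₁ refl) = n≤0⇒n≡0 (subst (indegIn D X u ≤_) indeg-u (indegIn≤indeg D X u))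
  ... | inj₂ (inj₂ refl) = n≤0⇒n≡0 (subst (indegIn D X v ≤_) indeg-v (indegIn≤indeg D X v))

  module _ (X : Subset n) (Xu : lookup X u ≡ true) (Xv : lookup X v ≡ true) where

    iH-augmented : iH (addEdge G u v) X ≡ arcsIn D X + 1
    iH-augmented = trans (iH-addEdge X simple Guv u≢v)
                         (cong₂ _+_ (iH≡arcsIn simple orient X) (cong 𝟙 (cong₂ _∧_ Xu Xv)))

    ∣X∣≡inner+2 : ∣ X ∣ ≡ count (Inner X) + 2
    ∣X∣≡inner+2 = trans (∣X∣≡count X) (count-removePair u≢v Xu Xv)

    bound≡inner*k : k * ∣ X ∣ ∸ 2 * k ≡ count (Inner X) * k
    bound≡inner*k = begin
      k * ∣ X ∣ ∸ 2 * k                    ≡⟨ cong (λ c → k * c ∸ 2 * k) ∣X∣≡inner+2 ⟩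
      k * (count (Inner X) + 2) ∸ 2 * k    ≡⟨ cong (_∸ 2 * k) (*-distribˡ-+ k _ 2) ⟩
      k * count (Inner X) + k * 2 ∸ 2 * k  ≡⟨ cong₂ (λ a b → a + b ∸ 2 * k) (*-comm k _) (*-comm k 2) ⟩
      count (Inner X) * k + 2 * k ∸ 2 * k  ≡⟨ m+n∸n≡m _ (2 * k) ⟩
      count (Inner X) * k                  ∎
      where open ≡-Reasoning

  module _ (reachable : AllReachableFromDeficient) (X : Subset n) (3≤∣X∣ : 3 ≤ ∣ X ∣)
           (Xu : lookup X u ≡ true) (Xv : lookup X v ≡ true) where

    deficient-inner : ∃ λ a → Inner X a ≡ true × indegIn D X a < k
    deficient-inner with any? (λ a → (Inner X a Bool.≟ true) ×-dec (indegIn D X a ℕ.<? k))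
    ... | yes found = found
    ... | no none =
      let w , inner-w = count>0 (+-cancelʳ-≤ 2 1 _ (subst (3 ≤_) (∣X∣≡inner+2 X Xu Xv) 3≤∣X∣))
          Xw , w≢u , w≢v = removePair-sound {p = lookup X} inner-w
          z , z≢u , z≢v , z<k , path = reachable w w≢u w≢v
          Xz = Path-closed closed path Xw
      in contradiction z<k (≤⇒≯ (≤-trans (saturated z (removePair-intro {p = lookup X} Xz z≢u z≢v))
                                         (indegIn≤indeg D X z)))
      where
      saturated : ∀ j → Inner X j ≡ true → k ≤ indegIn D X j
      saturated j inner-j = ≮⇒≥ λ lt → none (j , inner-j , lt)
      closed : PredClosed D (lookup X)
      closed {i} {j} dij Xj = indegIn-full⇒preds∈X D X (≤-trans (indeg≤k j) (saturated j
        (removePair-intro {p = lookup X} Xj (no-arc-into D indeg-u dij) (no-arc-into D indeg-v dij)))) dij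

    iH-augmented≤ : iH (addEdge G u v) X ≤ k * ∣ X ∣ ∸ 2 * k
    iH-augmented≤ =
      let a , inner-a , a<k = deficient-inner in begin
      iH (addEdge G u v) X  ≡⟨ iH-augmented X Xu Xv ⟩
      arcsIn D X + 1        ≡⟨ +-comm (arcsIn D X) 1 ⟩
      suc (arcsIn D X)      ≤⟨ ∑<count* (indegIn-outer X) indegIn≤k a inner-a a<k ⟩
      count (Inner X) * k   ≡⟨ bound≡inner*k X Xu Xv ⟨
      k * ∣ X ∣ ∸ 2 * k     ∎
      where
      open ≤-Reasoning
      indegIn≤k : ∀ j → indegIn D X j ≤ k
      indegIn≤k j = ≤-trans (indegIn≤indeg D X j) (indeg≤k j)

  sparse-augmented : Sparse k G → AllReachableFromDeficient → Sparse k (addEdge G u v)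
  sparse-augmented sparse reachable X 3≤∣X∣ with lookup X u ∧ lookup X v in uv∈X
  ... | true = iH-augmented≤ reachable X 3≤∣X∣ (Bool.∧-conicalˡ _ _ uv∈X) (Bool.∧-conicalʳ _ _ uv∈X)
  ... | false = begin
    iH (addEdge G u v) X                  ≡⟨ iH-addEdge X simple Guv u≢v ⟩
    iH G X + 𝟙 (lookup X u ∧ lookup X v)  ≡⟨ cong (λ b → iH G X + 𝟙 b) uv∈X ⟩
    iH G X + 0                            ≡⟨ +-identityʳ (iH G X) ⟩
    iH G X                                ≤⟨ sparse X 3≤∣X∣ ⟩
    k * ∣ X ∣ ∸ 2 * k                     ∎
    where open ≤-Reasoning

  module _ (sparse′ : Sparse k (addEdge G u v)) (w : Fin n) (w≢u : w ≢ u) (w≢v : w ≢ v) where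
    open Ancestors (ancestors D w)

    private
      X : Subset n
      X = tabulate (λ j → member j ∨ ⌊ j ≟ u ⌋ ∨ ⌊ j ≟ v ⌋)

      lookup-X : ∀ j → lookup X j ≡ member j ∨ ⌊ j ≟ u ⌋ ∨ ⌊ j ≟ v ⌋
      lookup-X = lookup∘tabulate _

      Xu : lookup X u ≡ true
      Xu rewrite lookup-X u | ⌊⌋-true (u ≟ u) refl = Bool.∨-zeroʳ (member u)

      Xv : lookup X v ≡ true
      Xv rewrite lookup-X v | ⌊⌋-true (v ≟ v) refl | Bool.∨-zeroʳ ⌊ v ≟ u ⌋ = Bool.∨-zeroʳ (member v)

      member⇒X : ∀ {j} → member j ≡ true → lookup X j ≡ true
      member⇒X {j} mj rewrite lookup-X j | mj = refl

      inner⇒member : ∀ {j} → Inner X j ≡ true → member j ≡ true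
      inner⇒member {j} inner with removePair-sound {p = lookup X} inner
      ... | Xj , j≢u , j≢v rewrite lookup-X j | ⌊⌋-false (j ≟ u) j≢u | ⌊⌋-false (j ≟ v) j≢v =
        trans (sym (Bool.∨-identityʳ (member j))) Xj

      3≤∣X∣ : 3 ≤ ∣ X ∣
      3≤∣X∣ = subst (3 ≤_) (sym (∣X∣≡inner+2 X Xu Xv))
        (+-monoˡ-≤ 2 (count-pos w (removePair-intro {p = lookup X} (member⇒X target) w≢u w≢v)))

    reachable-from-deficient : ReachableFromDeficient w
    reachable-from-deficient
      with any? (λ z → ¬? (z ≟ u) ×-dec ¬? (z ≟ v) ×-dec (indeg D z ℕ.<? k) ×-dec (member z Bool.≟ true))
    ... | yes (z , z≢u , z≢v , z<k , mz) = z , z≢u , z≢v , z<k , sound mz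
    ... | no none = contradiction (sparse′ X 3≤∣X∣) (<⇒≱ (begin-strict
      k * ∣ X ∣ ∸ 2 * k     ≡⟨ bound≡inner*k X Xu Xv ⟩
      count (Inner X) * k   ≤⟨ count*≤∑ saturated ⟩
      arcsIn D X            <⟨ m<m+n (arcsIn D X) (s≤s z≤n) ⟩
      arcsIn D X + 1        ≡⟨ iH-augmented X Xu Xv ⟨
      iH (addEdge G u v) X  ∎))
      where
      open ≤-Reasoning
      saturated : ∀ j → Inner X j ≡ true → k ≤ indegIn D X j
      saturated j inner-j =
        let Xj , j≢u , j≢v = removePair-sound {p = lookup X} inner-j
            mj = inner⇒member inner-j
        in ≤-trans (≮⇒≥ λ lt → none (j , j≢u , j≢v , lt , mj))
                   (indegIn-full D X Xj (λ dij → member⇒X (closed dij mj)))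

lemma1 : (n k : ℕ) → 1 ≤ k → (G : Graph n) → IsSimple G → Sparse k G →
    (u v : Fin n) → u ≢ v → G u v ≡ false →
    (D : Digraph n) → IsOrientation D G → (∀ (x : Fin n) → indeg D x ≤ k) →
    indeg D u ≡ 0 → indeg D v ≡ 0 →
    (Sparse k (addEdge G u v) ⇔
      (∀ (w : Fin n) → w ≢ u → w ≢ v →
        ∃[ z ] (z ≢ u × z ≢ v × indeg D z < k × Path D z w)))
lemma1 n k _ G simple sparse u v u≢v Guv D orient indeg≤k indeg-u indeg-v =
  mk⇔ reachable-from-deficient (sparse-augmented sparse)
  where open Augmentation simple orient indeg≤k indeg-u indeg-v u≢v Guv
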